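{- Let $G=(V,E)$ be a connected undirected graph with positive resistances $r\in\mathbb{R}^E$, Laplacian $\mathbf{L}$, and supply vector $\mathbf{b}\in\mathbb{R}^V$ with $\sum_i b(i)=0$. Let $\mathbf{p}\in\mathbb{R}^V$ and let $C$ be a nonempty proper subset of $V$. Let $\Delta=(S(C)-f(C))R(C)$ and $\mathbf{p}'=\mathbf{p}+\Delta\mathbbm{1}_C$. Then $\mathcal{B}(\mathbf{p}')-\mathcal{B}(\mathbf{p})=\Delta^2/R(C)$.
   Context: $\mathbf{L}=\sum_{ij\in E}\frac{1}{r(i,j)}(\mathbf{e}_i-\mathbf{e}_j)(\mathbf{e}_i-\mathbf{e}_j)^\top$. The potential bound is $\mathcal{B}(\mathbf{p})=2\mathbf{b}^\top\mathbf{p}-\mathbf{p}^\top\mathbf{L}\mathbf{p}$. $\mathbbm{1}_C$ is the indicator vector of $C$. $\delta(C)$ is the set of edges with exactly one endpoint in $C$; $S(C)=\sum_{v\in C}b(v)$; $R(C)=\big(\sum_{kl\in\delta(C)}1/r(k,l)\big)^{ -1}$; $f(C)=\sum_{kl\in E,\,k\in C,\,l\notin C}\frac{p(k)-p(l)}{r(k,l)}$ (computed from $\mathbf{p}$). -}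

module Defs where

open import Level using (Level; _⊔_; suc)
open import Data.Nat using (ℕ; zero) renaming (suc to sucℕ)
open import Data.Fin using (Fin; _≟_) renaming (zero to fz; suc to fs)
open import Data.Bool using (Bool; true; false; _∧_; not; _xor_; if_then_else_)
open import Relation.Nullary using (¬_; does)
open import Relation.Binary.Core using (Rel)
open import Relation.Binary.Structures using (IsStrictPartialOrder)
open import Relation.Binary.PropositionalEquality using (_≡_; _≢_)
open import Algebra.Bundles using (CommutativeRing)

-- An ordered field with a total inverse (x ⁻¹ only specified for x ≉ 0).
-- ℝ is the intended model; no real numbers exist in agda-stdlib.
record OrderedField (c ℓ₁ ℓ₂ : Level) : Set (suc (c ⊔ ℓ₁ ⊔ ℓ₂)) where
  infix  4 _<_
  infix  8 _⁻¹
  field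
    commutativeRing : CommutativeRing c ℓ₁
  open CommutativeRing commutativeRing public
  field
    _<_                  : Rel Carrier ℓ₂
    <-isStrictPartialOrder : IsStrictPartialOrder _≈_ _<_
    +-monoˡ-<            : ∀ {x y} z → x < y → x + z < y + z
    *-pos                : ∀ {x y} → 0# < x → 0# < y → 0# < x * y
    0<1                  : 0# < 1#
    _⁻¹                  : Carrier → Carrier
    ⁻¹-cong              : ∀ {x y} → x ≈ y → x ⁻¹ ≈ y ⁻¹
    ⁻¹-inverse           : ∀ x → ¬ (x ≈ 0#) → x * x ⁻¹ ≈ 1#

-- Finite undirected (multi)graph on vertex set Fin n with m edges;
-- edge e joins src e and dst e (orientation is only a labelling).
record Graph (n : ℕ) : Set where
  field
    m        : ℕ
    src dst  : Fin m → Fin n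
    loopless : ∀ e → src e ≢ dst e

data Reach {n : ℕ} (G : Graph n) (u : Fin n) : Fin n → Set where
  here  : Reach G u u
  fwd   : ∀ {v} e → Reach G u (Graph.src G e) → Graph.dst G e ≡ v → Reach G u v
  bwd   : ∀ {v} e → Reach G u (Graph.dst G e) → Graph.src G e ≡ v → Reach G u v

Connected : ∀ {n} → Graph n → Set
Connected {n} G = ∀ (u v : Fin n) → Reach G u v

module _ {c ℓ₁ ℓ₂} (F : OrderedField c ℓ₁ ℓ₂) where
  open OrderedField F

  ∑ : ∀ k → (Fin k → Carrier) → Carrier
  ∑ zero     f = 0#
  ∑ (sucℕ k) f = f fz + ∑ k (λ i → f (fs i))

  [_] : Bool → Carrier
  [ true ]  = 1#
  [ false ] = 0#

  δ : ∀ {n} → Fin n → Fin n → Carrier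
  δ i j = [ does (i ≟ j) ]

  module _ {n : ℕ} (G : Graph n) (r : Fin (Graph.m G) → Carrier) where
    open Graph G

    cond : Fin m → Carrier
    cond e = r e ⁻¹

    -- Laplacian L = Σ_e (1/r e) (e_i - e_j)(e_i - e_j)ᵀ, entrywise
    Laplacian : Fin n → Fin n → Carrier
    Laplacian u v = ∑ m (λ e → cond e * ((δ u (src e) - δ u (dst e)) * (δ v (src e) - δ v (dst e))))

    dot : (Fin n → Carrier) → (Fin n → Carrier) → Carrier
    dot x y = ∑ n (λ i → x i * y i)

    bound : (b p : Fin n → Carrier) → Carrier
    bound b p = (1# + 1#) * dot b p - ∑ n (λ u → ∑ n (λ v → p u * (Laplacian u v * p v)))

    indicator : (Fin n → Bool) → Fin n → Carrier
    indicator C v = [ C v ]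

    S : (b : Fin n → Carrier) → (Fin n → Bool) → Carrier
    S b C = ∑ n (λ v → [ C v ] * b v)

    R : (Fin n → Bool) → Carrier
    R C = (∑ m (λ e → [ C (src e) xor C (dst e) ] * cond e)) ⁻¹

    flow : (p : Fin n → Carrier) → (Fin n → Bool) → Carrier
    flow p C = ∑ m (λ e →
        [ C (src e) ∧ not (C (dst e)) ] * ((p (src e) - p (dst e)) * cond e)
      + [ C (dst e) ∧ not (C (src e)) ] * ((p (dst e) - p (src e)) * cond e))

-- The quadratic form pᵀ L p is the energy Σₑ (p(src e) − p(dst e))² / r(e). Raising the
-- potential on C by D only changes the energy of the edges crossing the cut, which gives
--   B(p + D 1_C) − B(p) = 2 D (S(C) − f(C)) − D² / R(C),
-- a quadratic in D whose value at D = (S(C) − f(C)) R(C) is D² / R(C). Connectivity provides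
-- an edge across the cut, so 1 / R(C) is nonzero and R(C) is a genuine inverse.
module Submission where

open import Defs
open import Level using (Level)
open import Data.Nat using (ℕ)
open import Data.Fin using (Fin)
open import Data.Bool using (Bool; true; false)
open import Data.Product using (∃)
open import Relation.Binary.PropositionalEquality using (_≡_)

open import Algebra.Bundles using (CommutativeRing; RawRing)
import Algebra.Solver.Ring.AlmostCommutativeRing as ACR
open import Data.Bool using (_∧_; not; _xor_)
open import Data.Fin using () renaming (zero to fz; suc to fs)
open import Data.Maybe using (Maybe; just; nothing)
open import Data.Nat as ℕ using (zero; suc)
import Data.Nat.Properties as ℕ
open import Data.Product using (_×_; _,_)
open import Data.Sum as Sum using (_⊎_; inj₁; inj₂)
open import Relation.Binary.Structures using (IsStrictPartialOrder)
import Relation.Binary.PropositionalEquality as ≡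
open import Relation.Nullary using (yes; ¬_)

-- The library's ring solvers need natural-number coefficients (no subtraction) or decidable
-- equality on the ring; integer coefficients, which every commutative ring receives, need neither.
module IntegerCoefficientSolver {c ℓ} (R : CommutativeRing c ℓ) where
  open CommutativeRing R
  open import Relation.Binary.Reasoning.Setoid setoid
  open import Algebra.Properties.Ring ring using (-‿distribˡ-*; -‿distribʳ-*; -0#≈0#; -‿involutive)
  open import Algebra.Properties.AbelianGroup +-abelianGroup using (⁻¹-∙-comm; ⁻¹-anti-homo‿-)
  open import Algebra.Properties.CommutativeSemigroup +-commutativeSemigroup using (interchange)
  open import Algebra.Properties.Monoid.Mult.TCOptimised +-monoid using (1+×; ×-homo-+) renaming (_×_ to _×′_)
  open import Algebra.Properties.Semiring.Mult.TCOptimised semiring using (×1-homo-*)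

  ι : ℕ → Carrier
  ι n = n ×′ 1#

  -- The integer a − b, kept normalised (one component zero) so that equal coefficients are equal pairs.
  ℤ₂ : Set
  ℤ₂ = ℕ × ℕ

  normalise : ℕ → ℕ → ℤ₂
  normalise a b = a ℕ.∸ b , b ℕ.∸ a

  difference : ℤ₂ → Carrier
  difference (a , b) = ι a - ι b

  -- Defined by cases so that the constants 0, 1 and 2 denote 0#, 1# and 1# + 1# on the nose.
  ⟦_⟧ : ℤ₂ → Carrier
  ⟦ a , zero ⟧ = ι a
  ⟦ a , suc b ⟧ = difference (a , suc b)

  x-0≈x : ∀ x → x - 0# ≈ x
  x-0≈x x = trans (+-congˡ -0#≈0#) (+-identityʳ x)

  ⟦⟧≈difference : ∀ z → ⟦ z ⟧ ≈ difference z
  ⟦⟧≈difference (a , zero) = sym (x-0≈x (ι a))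
  ⟦⟧≈difference (a , suc b) = refl

  -‿+-distrib : ∀ x y z w → (x + y) - (z + w) ≈ (x - z) + (y - w)
  -‿+-distrib x y z w = trans (+-congˡ (sym (⁻¹-∙-comm z w))) (interchange x y (- z) (- w))

  +-cancelˡ-difference : ∀ z x y → (z + x) - (z + y) ≈ x - y
  +-cancelˡ-difference z x y = begin
    (z + x) - (z + y)   ≈⟨ -‿+-distrib z x z y ⟩
    (z - z) + (x - y)   ≈⟨ +-congʳ (-‿inverseʳ z) ⟩
    0# + (x - y)        ≈⟨ +-identityˡ (x - y) ⟩
    x - y               ∎

  normalise-sound : ∀ a b → difference (normalise a b) ≈ difference (a , b)
  normalise-sound zero    zero    = refl
  normalise-sound zero    (suc b) = refl
  normalise-sound (suc a) zero    = refl
  normalise-sound (suc a) (suc b) = begin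
    difference (normalise a b)  ≈⟨ normalise-sound a b ⟩
    ι a - ι b                   ≈⟨ +-cancelˡ-difference 1# (ι a) (ι b) ⟨
    (1# + ι a) - (1# + ι b)     ≈⟨ +-cong (1+× a 1#) (-‿cong (1+× b 1#)) ⟨
    ι (suc a) - ι (suc b)       ∎

  ⟦normalise⟧ : ∀ a b → ⟦ normalise a b ⟧ ≈ ι a - ι b
  ⟦normalise⟧ a b = trans (⟦⟧≈difference (normalise a b)) (normalise-sound a b)

  -‿*-expand : ∀ x y z w → (x - y) * (z - w) ≈ (x * z + y * w) - (x * w + y * z)
  -‿*-expand x y z w = begin
    (x - y) * (z - w)                                  ≈⟨ distribʳ (z - w) x (- y) ⟩
    x * (z - w) + - y * (z - w)                        ≈⟨ +-cong (distribˡ x z (- w)) (distribˡ (- y) z (- w)) ⟩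
    (x * z + x * - w) + (- y * z + - y * - w)          ≈⟨ +-cong (+-congˡ (sym (-‿distribʳ-* x w)))
                                                                  (+-cong (sym (-‿distribˡ-* y z)) (-y*-w≈yw)) ⟩
    (x * z + - (x * w)) + (- (y * z) + y * w)          ≈⟨ +-congˡ (+-comm (- (y * z)) (y * w)) ⟩
    (x * z + - (x * w)) + (y * w + - (y * z))          ≈⟨ interchange (x * z) (- (x * w)) (y * w) (- (y * z)) ⟩
    (x * z + y * w) + (- (x * w) + - (y * z))          ≈⟨ +-congˡ (⁻¹-∙-comm (x * w) (y * z)) ⟩
    (x * z + y * w) - (x * w + y * z)                  ∎
    where
    -y*-w≈yw : - y * - w ≈ y * w
    -y*-w≈yw = trans (sym (-‿distribˡ-* y (- w))) (trans (-‿cong (sym (-‿distribʳ-* y w))) (-‿involutive (y * w)))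

  coefficients : RawRing _ _
  coefficients = record
    { Carrier = ℤ₂
    ; _≈_ = _≡_
    ; _+_ = λ { (a , b) (c , d) → normalise (a ℕ.+ c) (b ℕ.+ d) }
    ; _*_ = λ { (a , b) (c , d) → normalise (a ℕ.* c ℕ.+ b ℕ.* d) (a ℕ.* d ℕ.+ b ℕ.* c) }
    ; -_ = λ { (a , b) → b , a }
    ; 0# = 0 , 0
    ; 1# = 1 , 0
    }

  almostCommutativeRing : ACR.AlmostCommutativeRing _ _
  almostCommutativeRing = ACR.fromCommutativeRing R

  homomorphism : coefficients ACR.-Raw-AlmostCommutative⟶ almostCommutativeRing
  homomorphism = record
    { ⟦_⟧ = ⟦_⟧
    ; +-homo = λ { (a , b) (c , d) → begin
        ⟦ normalise (a ℕ.+ c) (b ℕ.+ d) ⟧   ≈⟨ ⟦normalise⟧ (a ℕ.+ c) (b ℕ.+ d) ⟩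
        ι (a ℕ.+ c) - ι (b ℕ.+ d)           ≈⟨ +-cong (×-homo-+ 1# a c) (-‿cong (×-homo-+ 1# b d)) ⟩
        (ι a + ι c) - (ι b + ι d)           ≈⟨ -‿+-distrib (ι a) (ι c) (ι b) (ι d) ⟩
        (ι a - ι b) + (ι c - ι d)           ≈⟨ +-cong (⟦⟧≈difference (a , b)) (⟦⟧≈difference (c , d)) ⟨
        ⟦ a , b ⟧ + ⟦ c , d ⟧               ∎ }
    ; *-homo = λ { (a , b) (c , d) → begin
        ⟦ normalise (a ℕ.* c ℕ.+ b ℕ.* d) (a ℕ.* d ℕ.+ b ℕ.* c) ⟧
          ≈⟨ ⟦normalise⟧ (a ℕ.* c ℕ.+ b ℕ.* d) (a ℕ.* d ℕ.+ b ℕ.* c) ⟩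
        ι (a ℕ.* c ℕ.+ b ℕ.* d) - ι (a ℕ.* d ℕ.+ b ℕ.* c)
          ≈⟨ +-cong (trans (×-homo-+ 1# (a ℕ.* c) (b ℕ.* d)) (+-cong (×1-homo-* a c) (×1-homo-* b d)))
                    (-‿cong (trans (×-homo-+ 1# (a ℕ.* d) (b ℕ.* c)) (+-cong (×1-homo-* a d) (×1-homo-* b c)))) ⟩
        (ι a * ι c + ι b * ι d) - (ι a * ι d + ι b * ι c)
          ≈⟨ -‿*-expand (ι a) (ι b) (ι c) (ι d) ⟨
        (ι a - ι b) * (ι c - ι d)
          ≈⟨ *-cong (⟦⟧≈difference (a , b)) (⟦⟧≈difference (c , d)) ⟨
        ⟦ a , b ⟧ * ⟦ c , d ⟧ ∎ }
    ; -‿homo = λ { (a , b) → begin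
        ⟦ b , a ⟧       ≈⟨ ⟦⟧≈difference (b , a) ⟩
        ι b - ι a       ≈⟨ ⁻¹-anti-homo‿- (ι a) (ι b) ⟨
        - (ι a - ι b)   ≈⟨ -‿cong (⟦⟧≈difference (a , b)) ⟨
        - ⟦ a , b ⟧     ∎ }
    ; 0-homo = refl
    ; 1-homo = refl
    }

  _≟ᶜ_ : ∀ x y → Maybe (⟦ x ⟧ ≈ ⟦ y ⟧)
  (a , b) ≟ᶜ (c , d) with a ℕ.≟ c | b ℕ.≟ d
  ... | yes ≡.refl | yes ≡.refl = just refl
  ... | _          | _          = nothing

  open import Algebra.Solver.Ring coefficients almostCommutativeRing homomorphism _≟ᶜ_ public
    using (solve; _:=_; _:+_; _:*_; :-_; _:-_; con)

module Summation {c ℓ₁ ℓ₂} (F : OrderedField c ℓ₁ ℓ₂) where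
  open OrderedField F
  open import Relation.Binary.Reasoning.Setoid setoid
  open import Algebra.Properties.Semiring.Sum semiring
    using (sum; sum-cong-≋; sum-replicate-zero; ∑-distrib-+; ∑-comm; *-distribˡ-sum; *-distribʳ-sum)
  open import Algebra.Properties.Ring ring using (-1*x≈-x; x[y-z]≈xy-xz)

  ∑≡sum : ∀ k (f : Fin k → Carrier) → ∑ F k f ≡ sum f
  ∑≡sum zero    f = ≡.refl
  ∑≡sum (suc k) f = ≡.cong (f fz +_) (∑≡sum k (λ i → f (fs i)))

  ∑-cong : ∀ k {f g : Fin k → Carrier} → (∀ i → f i ≈ g i) → ∑ F k f ≈ ∑ F k g
  ∑-cong k {f} {g} f≈g rewrite ∑≡sum k f | ∑≡sum k g = sum-cong-≋ f≈g

  ∑-+ : ∀ k (f g : Fin k → Carrier) → ∑ F k (λ i → f i + g i) ≈ ∑ F k f + ∑ F k g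
  ∑-+ k f g rewrite ∑≡sum k (λ i → f i + g i) | ∑≡sum k f | ∑≡sum k g = ∑-distrib-+ f g

  ∑-*ˡ : ∀ k a (f : Fin k → Carrier) → ∑ F k (λ i → a * f i) ≈ a * ∑ F k f
  ∑-*ˡ k a f rewrite ∑≡sum k (λ i → a * f i) | ∑≡sum k f = sym (*-distribˡ-sum a f)

  ∑-*ʳ : ∀ k a (f : Fin k → Carrier) → ∑ F k (λ i → f i * a) ≈ ∑ F k f * a
  ∑-*ʳ k a f rewrite ∑≡sum k (λ i → f i * a) | ∑≡sum k f = sym (*-distribʳ-sum a f)

  ∑-swap : ∀ k l (f : Fin k → Fin l → Carrier) →
           ∑ F k (λ i → ∑ F l (f i)) ≈ ∑ F l (λ j → ∑ F k (λ i → f i j))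
  ∑-swap k l f = begin
    ∑ F k (λ i → ∑ F l (f i))        ≈⟨ ∑-cong k (λ i → reflexive (∑≡sum l (f i))) ⟩
    ∑ F k (λ i → sum (f i))          ≡⟨ ∑≡sum k _ ⟩
    sum (λ i → sum (f i))            ≈⟨ ∑-comm f ⟩
    sum (λ j → sum (λ i → f i j))    ≡⟨ ∑≡sum l _ ⟨
    ∑ F l (λ j → sum (λ i → f i j))  ≈⟨ ∑-cong l (λ j → reflexive (∑≡sum k (λ i → f i j))) ⟨
    ∑ F l (λ j → ∑ F k (λ i → f i j)) ∎

  ∑-neg : ∀ k (f : Fin k → Carrier) → ∑ F k (λ i → - f i) ≈ - ∑ F k f
  ∑-neg k f = begin
    ∑ F k (λ i → - f i)       ≈⟨ ∑-cong k (λ i → -1*x≈-x (f i)) ⟨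
    ∑ F k (λ i → - 1# * f i)  ≈⟨ ∑-*ˡ k (- 1#) f ⟩
    - 1# * ∑ F k f            ≈⟨ -1*x≈-x (∑ F k f) ⟩
    - ∑ F k f                 ∎

  ∑-product : ∀ k l (f : Fin k → Carrier) (g : Fin l → Carrier) →
              ∑ F k (λ i → ∑ F l (λ j → f i * g j)) ≈ ∑ F k f * ∑ F l g
  ∑-product k l f g = trans (∑-cong k (λ i → ∑-*ˡ l (f i) g)) (∑-*ʳ k (∑ F l g) f)

  ∑-0 : ∀ k → ∑ F k (λ _ → 0#) ≈ 0#
  ∑-0 k = trans (reflexive (∑≡sum k _)) (sum-replicate-zero k)

  ∑-δ : ∀ k (g : Fin k → Carrier) w → ∑ F k (λ u → g u * δ F u w) ≈ g w
  ∑-δ (suc k) g fz = begin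
    g fz * 1# + ∑ F k (λ u → g (fs u) * 0#)  ≈⟨ +-cong (*-identityʳ (g fz)) (∑-cong k (λ u → zeroʳ (g (fs u)))) ⟩
    g fz + ∑ F k (λ _ → 0#)                  ≈⟨ +-congˡ (∑-0 k) ⟩
    g fz + 0#                                ≈⟨ +-identityʳ (g fz) ⟩
    g fz                                     ∎
  ∑-δ (suc k) g (fs w) = trans (+-cong (zeroʳ (g fz)) (∑-δ k (λ u → g (fs u)) w)) (+-identityˡ (g (fs w)))

  ∑-*-δ-difference : ∀ k (g : Fin k → Carrier) v w →
                     ∑ F k (λ u → g u * (δ F u v - δ F u w)) ≈ g v - g w
  ∑-*-δ-difference k g v w = begin
    ∑ F k (λ u → g u * (δ F u v - δ F u w))        ≈⟨ ∑-cong k (λ u → x[y-z]≈xy-xz (g u) _ _) ⟩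
    ∑ F k (λ u → g u * δ F u v - g u * δ F u w)    ≈⟨ ∑-+ k _ _ ⟩
    ∑ F k (λ u → g u * δ F u v) + ∑ F k (λ u → - (g u * δ F u w))
                                                  ≈⟨ +-cong (∑-δ k g v) (trans (∑-neg k _) (-‿cong (∑-δ k g w))) ⟩
    g v - g w                                      ∎

module OrderedFieldFacts {c ℓ₁ ℓ₂} (F : OrderedField c ℓ₁ ℓ₂) where
  open OrderedField F
  open IsStrictPartialOrder <-isStrictPartialOrder using (irrefl; <-respʳ-≈) renaming (trans to <-trans)
  open IntegerCoefficientSolver commutativeRing using (solve; _:=_; _:+_; _:*_; :-_; _:-_; con)
  open import Relation.Binary.Reasoning.Setoid setoid

  pos⇒≉0 : ∀ {x} → 0# < x → ¬ x ≈ 0#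
  pos⇒≉0 0<x x≈0 = irrefl (sym x≈0) 0<x

  *≈1⇒≉0ʳ : ∀ {x y} → x * y ≈ 1# → ¬ y ≈ 0#
  *≈1⇒≉0ʳ {x} xy≈1 y≈0 = pos⇒≉0 0<1 (trans (sym xy≈1) (trans (*-congˡ y≈0) (zeroʳ x)))

  ⁻¹-involutive : ∀ {x} → ¬ x ≈ 0# → x ⁻¹ ⁻¹ ≈ x
  ⁻¹-involutive {x} x≉0 = begin
    x ⁻¹ ⁻¹                 ≈⟨ *-identityˡ _ ⟨
    1# * x ⁻¹ ⁻¹            ≈⟨ *-congʳ (⁻¹-inverse x x≉0) ⟨
    (x * x ⁻¹) * x ⁻¹ ⁻¹    ≈⟨ *-assoc x _ _ ⟩
    x * (x ⁻¹ * x ⁻¹ ⁻¹)    ≈⟨ *-congˡ (⁻¹-inverse (x ⁻¹) (*≈1⇒≉0ʳ (⁻¹-inverse x x≉0))) ⟩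
    x * 1#                  ≈⟨ *-identityʳ x ⟩
    x                       ∎

  quadratic-gain : ∀ s K → ¬ K ≈ 0# →
                   let Δ = s * K ⁻¹ in
                   ((1# + 1#) * Δ) * s - (Δ * Δ) * K ≈ (Δ * Δ) * K ⁻¹ ⁻¹
  quadratic-gain s K K≉0 = begin
    ((1# + 1#) * Δ) * s - (Δ * Δ) * K        ≈⟨ +-congʳ (*-congˡ ΔK≈s) ⟨
    ((1# + 1#) * Δ) * (Δ * K) - (Δ * Δ) * K  ≈⟨ solve 2 (λ Δ K → (con (2 , 0) :* Δ) :* (Δ :* K) :- (Δ :* Δ) :* K
                                                              := (Δ :* Δ) :* K) refl Δ K ⟩
    (Δ * Δ) * K                              ≈⟨ *-congˡ (⁻¹-involutive K≉0) ⟨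
    (Δ * Δ) * K ⁻¹ ⁻¹                        ∎
    where
    Δ : Carrier
    Δ = s * K ⁻¹
    ΔK≈s : Δ * K ≈ s
    ΔK≈s = begin
      (s * K ⁻¹) * K  ≈⟨ *-assoc s _ K ⟩
      s * (K ⁻¹ * K)  ≈⟨ *-congˡ (trans (*-comm _ K) (⁻¹-inverse K K≉0)) ⟩
      s * 1#          ≈⟨ *-identityʳ s ⟩
      s               ∎

  indicator-difference : ∀ a b z →
                         ([ F ] a - [ F ] b) * z ≈ [ F ] (a ∧ not b) * z + [ F ] (b ∧ not a) * (- z)
  indicator-difference true  true  = solve 1
    (λ z → (con (1 , 0) :- con (1 , 0)) :* z := con (0 , 0) :* z :+ con (0 , 0) :* (:- z)) refl
  indicator-difference true  false = solve 1
    (λ z → (con (1 , 0) :- con (0 , 0)) :* z := con (1 , 0) :* z :+ con (0 , 0) :* (:- z)) refl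
  indicator-difference false true  = solve 1
    (λ z → (con (0 , 0) :- con (1 , 0)) :* z := con (0 , 0) :* z :+ con (1 , 0) :* (:- z)) refl
  indicator-difference false false = solve 1
    (λ z → (con (0 , 0) :- con (0 , 0)) :* z := con (0 , 0) :* z :+ con (0 , 0) :* (:- z)) refl

  indicator-difference² : ∀ a b → ([ F ] a - [ F ] b) * ([ F ] a - [ F ] b) ≈ [ F ] (a xor b)
  indicator-difference² true  true  = solve 0
    ((con (1 , 0) :- con (1 , 0)) :* (con (1 , 0) :- con (1 , 0)) := con (0 , 0)) refl
  indicator-difference² true  false = solve 0
    ((con (1 , 0) :- con (0 , 0)) :* (con (1 , 0) :- con (0 , 0)) := con (1 , 0)) refl
  indicator-difference² false true  = solve 0
    ((con (0 , 0) :- con (1 , 0)) :* (con (0 , 0) :- con (1 , 0)) := con (1 , 0)) refl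
  indicator-difference² false false = solve 0
    ((con (0 , 0) :- con (0 , 0)) :* (con (0 , 0) :- con (0 , 0)) := con (0 , 0)) refl

  NonNegative : Carrier → Set _
  NonNegative x = x ≈ 0# ⊎ 0# < x

  NonNegative-resp : ∀ {x y} → x ≈ y → NonNegative x → NonNegative y
  NonNegative-resp x≈y = Sum.map (trans (sym x≈y)) (<-respʳ-≈ x≈y)

  +-pos-nonneg : ∀ {x y} → 0# < x → NonNegative y → 0# < x + y
  +-pos-nonneg {x} {y} 0<x (inj₁ y≈0) = <-respʳ-≈ (sym (trans (+-congˡ y≈0) (+-identityʳ x))) 0<x
  +-pos-nonneg {x} {y} 0<x (inj₂ 0<y) = <-trans (<-respʳ-≈ (sym (+-identityˡ y)) 0<y) (+-monoˡ-< y 0<x)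

  +-nonneg-pos : ∀ {x y} → NonNegative x → 0# < y → 0# < x + y
  +-nonneg-pos {x} {y} x≥0 0<y = <-respʳ-≈ (+-comm y x) (+-pos-nonneg 0<y x≥0)

  +-nonneg : ∀ {x y} → NonNegative x → NonNegative y → NonNegative (x + y)
  +-nonneg {x} {y} (inj₁ x≈0) y≥0 = NonNegative-resp (trans (sym (+-identityˡ y)) (+-congʳ (sym x≈0))) y≥0
  +-nonneg (inj₂ 0<x) y≥0 = inj₂ (+-pos-nonneg 0<x y≥0)

  *-pos-nonneg : ∀ {x y} → 0# < x → NonNegative y → NonNegative (x * y)
  *-pos-nonneg {x} 0<x (inj₁ y≈0) = inj₁ (trans (*-congˡ y≈0) (zeroʳ x))
  *-pos-nonneg 0<x (inj₂ 0<y) = inj₂ (*-pos 0<x 0<y)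

  [w]*pos-nonneg : ∀ w {x} → 0# < x → NonNegative ([ F ] w * x)
  [w]*pos-nonneg true  {x} 0<x = inj₂ (<-respʳ-≈ (sym (*-identityˡ x)) 0<x)
  [w]*pos-nonneg false {x} 0<x = inj₁ (zeroˡ x)

  ∏ : ∀ k → (Fin k → Carrier) → Carrier
  ∏ zero    x = 1#
  ∏ (suc k) x = x fz * ∏ k (λ i → x (fs i))

  ∏-pos : ∀ k (x : Fin k → Carrier) → (∀ i → 0# < x i) → 0# < ∏ k x
  ∏-pos zero    x x>0 = 0<1
  ∏-pos (suc k) x x>0 = *-pos (x>0 fz) (∏-pos k (λ i → x (fs i)) (λ i → x>0 (fs i)))

  -- The axioms do not give 0# < x ⁻¹ from 0# < x (there is no trichotomy),
  -- so sums of selected inverses are shown positive after clearing denominators.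
  ∑-selected-⁻¹ : ∀ k → (Fin k → Bool) → (Fin k → Carrier) → Carrier
  ∑-selected-⁻¹ k w x = ∑ F k (λ e → [ F ] (w e) * x e ⁻¹)

  ∑-selected-⁻¹*∏-suc : ∀ k w (x : Fin (suc k) → Carrier) → ¬ x fz ≈ 0# →
    ∑-selected-⁻¹ (suc k) w x * ∏ (suc k) x
      ≈ [ F ] (w fz) * ∏ k (λ i → x (fs i))
        + x fz * (∑-selected-⁻¹ k (λ i → w (fs i)) (λ i → x (fs i)) * ∏ k (λ i → x (fs i)))
  ∑-selected-⁻¹*∏-suc k w x x₀≉0 = trans
    (solve 5 (λ a i T x₀ P → (a :* i :+ T) :* (x₀ :* P) := a :* (x₀ :* i) :* P :+ x₀ :* (T :* P)) refl _ _ _ _ _)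
    (+-congʳ (*-congʳ (trans (*-congˡ (⁻¹-inverse (x fz) x₀≉0)) (*-identityʳ _))))

  ∑-selected-⁻¹*∏-nonneg : ∀ k w (x : Fin k → Carrier) → (∀ i → 0# < x i) →
                           NonNegative (∑-selected-⁻¹ k w x * ∏ k x)
  ∑-selected-⁻¹*∏-nonneg zero    w x x>0 = inj₁ (zeroˡ 1#)
  ∑-selected-⁻¹*∏-nonneg (suc k) w x x>0 =
    NonNegative-resp (sym (∑-selected-⁻¹*∏-suc k w x (pos⇒≉0 (x>0 fz))))
      (+-nonneg ([w]*pos-nonneg (w fz) (∏-pos k _ (λ i → x>0 (fs i))))
                (*-pos-nonneg (x>0 fz) (∑-selected-⁻¹*∏-nonneg k (λ i → w (fs i)) (λ i → x (fs i)) (λ i → x>0 (fs i)))))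

  ∑-selected-⁻¹*∏-pos : ∀ k w (x : Fin k → Carrier) → (∀ i → 0# < x i) → ∃ (λ i → w i ≡ true) →
                        0# < ∑-selected-⁻¹ k w x * ∏ k x
  ∑-selected-⁻¹*∏-pos (suc k) w x x>0 (i , wi) =
    <-respʳ-≈ (sym (∑-selected-⁻¹*∏-suc k w x (pos⇒≉0 (x>0 fz)))) (split i wi)
    where
    x>0′ : ∀ i → 0# < x (fs i)
    x>0′ i = x>0 (fs i)
    split : ∀ i → w i ≡ true →
            0# < [ F ] (w fz) * ∏ k (λ i → x (fs i))
                 + x fz * (∑-selected-⁻¹ k (λ i → w (fs i)) (λ i → x (fs i)) * ∏ k (λ i → x (fs i)))
    split fz     w₀ rewrite w₀ =
      +-pos-nonneg (<-respʳ-≈ (sym (*-identityˡ _)) (∏-pos k _ x>0′))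
                   (*-pos-nonneg (x>0 fz) (∑-selected-⁻¹*∏-nonneg k (λ i → w (fs i)) (λ i → x (fs i)) x>0′))
    split (fs i) wi =
      +-nonneg-pos ([w]*pos-nonneg (w fz) (∏-pos k _ x>0′))
                   (*-pos (x>0 fz) (∑-selected-⁻¹*∏-pos k (λ i → w (fs i)) (λ i → x (fs i)) x>0′ (i , wi)))

module ResistorNetwork {c ℓ₁ ℓ₂} (F : OrderedField c ℓ₁ ℓ₂) {n : ℕ} (G : Graph n)
                       (r : Fin (Graph.m G) → OrderedField.Carrier F) where
  open OrderedField F
  open Graph G
  open Summation F
  open OrderedFieldFacts F
  open IntegerCoefficientSolver commutativeRing using (solve; _:=_; _:+_; _:*_; _:-_; con)
  open import Relation.Binary.Reasoning.Setoid setoid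
  open import Algebra.Properties.Ring ring using (-‿distribˡ-*)
  open import Algebra.Properties.AbelianGroup +-abelianGroup using (⁻¹-anti-homo‿-)

  private
    c⟨_⟩ : Fin m → Carrier
    c⟨ e ⟩ = cond F G r e

  energy : (Fin n → Carrier) → Carrier
  energy x = ∑ F m (λ e → c⟨ e ⟩ * ((x (src e) - x (dst e)) * (x (src e) - x (dst e))))

  cutConductance : (Fin n → Bool) → Carrier
  cutConductance C = ∑ F m (λ e → [ F ] (C (src e) xor C (dst e)) * c⟨ e ⟩)

  quadraticForm≈energy : ∀ x → ∑ F n (λ u → ∑ F n (λ v → x u * (Laplacian F G r u v * x v))) ≈ energy x
  quadraticForm≈energy x = begin
    ∑ F n (λ u → ∑ F n (λ v → x u * (Laplacian F G r u v * x v)))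
      ≈⟨ ∑-cong n (λ u → ∑-cong n (λ v → trans (*-congˡ (sym (∑-*ʳ m (x v) _))) (sym (∑-*ˡ m (x u) _)))) ⟩
    ∑ F n (λ u → ∑ F n (λ v → ∑ F m (λ e → x u * (c⟨ e ⟩ * (a u e * a v e) * x v))))
      ≈⟨ ∑-cong n (λ u → ∑-swap n m _) ⟩
    ∑ F n (λ u → ∑ F m (λ e → ∑ F n (λ v → x u * (c⟨ e ⟩ * (a u e * a v e) * x v))))
      ≈⟨ ∑-swap n m _ ⟩
    ∑ F m (λ e → ∑ F n (λ u → ∑ F n (λ v → x u * (c⟨ e ⟩ * (a u e * a v e) * x v))))
      ≈⟨ ∑-cong m (λ e → ∑-cong n (λ u → ∑-cong n (λ v →
           solve 5 (λ X Y C A B → X :* (C :* (A :* B) :* Y) := (X :* A) :* (C :* (Y :* B))) refl _ _ _ _ _))) ⟩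
    ∑ F m (λ e → ∑ F n (λ u → ∑ F n (λ v → (x u * a u e) * (c⟨ e ⟩ * (x v * a v e)))))
      ≈⟨ ∑-cong m (λ e → ∑-product n n _ _) ⟩
    ∑ F m (λ e → ∑ F n (λ u → x u * a u e) * ∑ F n (λ v → c⟨ e ⟩ * (x v * a v e)))
      ≈⟨ ∑-cong m (λ e → *-cong (∑-*-δ-difference n x (src e) (dst e))
                                (trans (∑-*ˡ n c⟨ e ⟩ _) (*-congˡ (∑-*-δ-difference n x (src e) (dst e))))) ⟩
    ∑ F m (λ e → (x (src e) - x (dst e)) * (c⟨ e ⟩ * (x (src e) - x (dst e))))
      ≈⟨ ∑-cong m (λ e → solve 2 (λ C D → D :* (C :* D) := C :* (D :* D)) refl _ _) ⟩
    energy x ∎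
    where
    a : Fin n → Fin m → Carrier
    a u e = δ F u (src e) - δ F u (dst e)

  -- [ a ] - [ b ] is the jump of the shift across the edge: its sign selects the orientation
  -- counted by flow, and its square is the crossing indicator.
  edge-energy-shift : ∀ (a b : Bool) (x y c D : Carrier) →
    c * (((x + D * [ F ] a) - (y + D * [ F ] b)) * ((x + D * [ F ] a) - (y + D * [ F ] b)))
      ≈ c * ((x - y) * (x - y))
        + ((1# + 1#) * D) * ([ F ] (a ∧ not b) * ((x - y) * c) + [ F ] (b ∧ not a) * ((y - x) * c))
        + (D * D) * ([ F ] (a xor b) * c)
  edge-energy-shift a b x y c D = begin
    c * (((x + D * α) - (y + D * β)) * ((x + D * α) - (y + D * β)))
      ≈⟨ solve 6 (λ x y c D α β →
           c :* (((x :+ D :* α) :- (y :+ D :* β)) :* ((x :+ D :* α) :- (y :+ D :* β)))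
           := c :* ((x :- y) :* (x :- y)) :+ (con (2 , 0) :* D) :* ((α :- β) :* ((x :- y) :* c))
              :+ (D :* D) :* (((α :- β) :* (α :- β)) :* c)) refl x y c D α β ⟩
    c * ((x - y) * (x - y)) + ((1# + 1#) * D) * ((α - β) * ((x - y) * c)) + (D * D) * (((α - β) * (α - β)) * c)
      ≈⟨ +-cong (+-congˡ (*-congˡ (trans (indicator-difference a b _) (+-congˡ (*-congˡ reverse-edge)))))
                (*-congˡ (*-congʳ (indicator-difference² a b))) ⟩
    c * ((x - y) * (x - y))
      + ((1# + 1#) * D) * ([ F ] (a ∧ not b) * ((x - y) * c) + [ F ] (b ∧ not a) * ((y - x) * c))
      + (D * D) * ([ F ] (a xor b) * c) ∎
    where
    α β : Carrier
    α = [ F ] a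
    β = [ F ] b
    reverse-edge : - ((x - y) * c) ≈ (y - x) * c
    reverse-edge = trans (-‿distribˡ-* (x - y) c) (*-congʳ (⁻¹-anti-homo‿- x y))

  energy-shift : ∀ (p : Fin n → Carrier) (C : Fin n → Bool) D →
    energy (λ v → p v + D * [ F ] (C v))
      ≈ energy p + ((1# + 1#) * D) * flow F G r p C + (D * D) * cutConductance C
  energy-shift p C D = begin
    energy (λ v → p v + D * [ F ] (C v))
      ≈⟨ ∑-cong m (λ e → edge-energy-shift (C (src e)) (C (dst e)) (p (src e)) (p (dst e)) c⟨ e ⟩ D) ⟩
    ∑ F m (λ e → unshifted e + orientedFlow e + crossing e)  ≈⟨ ∑-+ m _ crossing ⟩
    ∑ F m (λ e → unshifted e + orientedFlow e) + ∑ F m crossing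
      ≈⟨ +-cong (∑-+ m unshifted orientedFlow) (∑-*ˡ m (D * D) _) ⟩
    energy p + ∑ F m orientedFlow + (D * D) * cutConductance C
      ≈⟨ +-congʳ (+-congˡ (∑-*ˡ m ((1# + 1#) * D) _)) ⟩
    energy p + ((1# + 1#) * D) * flow F G r p C + (D * D) * cutConductance C ∎
    where
    unshifted orientedFlow crossing : Fin m → Carrier
    unshifted e = c⟨ e ⟩ * ((p (src e) - p (dst e)) * (p (src e) - p (dst e)))
    orientedFlow e = ((1# + 1#) * D) *
      ([ F ] (C (src e) ∧ not (C (dst e))) * ((p (src e) - p (dst e)) * c⟨ e ⟩)
       + [ F ] (C (dst e) ∧ not (C (src e))) * ((p (dst e) - p (src e)) * c⟨ e ⟩))
    crossing e = (D * D) * ([ F ] (C (src e) xor C (dst e)) * c⟨ e ⟩)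

  dot-shift : ∀ (b p : Fin n → Carrier) (C : Fin n → Bool) D →
    dot F G r b (λ v → p v + D * [ F ] (C v)) ≈ dot F G r b p + D * S F G r b C
  dot-shift b p C D = begin
    ∑ F n (λ i → b i * (p i + D * [ F ] (C i)))
      ≈⟨ ∑-cong n (λ i → solve 4 (λ B P D X → B :* (P :+ D :* X) := B :* P :+ D :* (X :* B)) refl _ _ _ _) ⟩
    ∑ F n (λ i → b i * p i + D * ([ F ] (C i) * b i))  ≈⟨ ∑-+ n _ _ ⟩
    dot F G r b p + ∑ F n (λ i → D * ([ F ] (C i) * b i)) ≈⟨ +-congˡ (∑-*ˡ n D _) ⟩
    dot F G r b p + D * S F G r b C ∎

  bound-shift : ∀ (b p : Fin n → Carrier) (C : Fin n → Bool) D →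
    bound F G r b (λ v → p v + D * indicator F G r C v) - bound F G r b p
      ≈ ((1# + 1#) * D) * (S F G r b C - flow F G r p C) - (D * D) * cutConductance C
  bound-shift b p C D = begin
    bound F G r b p′ - bound F G r b p
      ≈⟨ +-cong (+-cong (*-congˡ (dot-shift b p C D))
                        (-‿cong (trans (quadraticForm≈energy p′) (energy-shift p C D))))
                (-‿cong (+-congˡ (-‿cong (quadraticForm≈energy p)))) ⟩
    ((1# + 1#) * (bp + D * s) - (energy p + ((1# + 1#) * D) * f + (D * D) * K)) - ((1# + 1#) * bp - energy p)
      ≈⟨ solve 6 (λ bp s f E K D →
           (con (2 , 0) :* (bp :+ D :* s) :- (E :+ (con (2 , 0) :* D) :* f :+ (D :* D) :* K))
             :- (con (2 , 0) :* bp :- E)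
           := (con (2 , 0) :* D) :* (s :- f) :- (D :* D) :* K) refl bp s f (energy p) K D ⟩
    ((1# + 1#) * D) * (s - f) - (D * D) * K ∎
    where
    p′ : Fin n → Carrier
    p′ v = p v + D * indicator F G r C v
    bp s f K : Carrier
    bp = dot F G r b p
    s = S F G r b C
    f = flow F G r p C
    K = cutConductance C

  crossing-edge : ∀ (C : Fin n → Bool) {u v} → Reach G u v → C u ≡ true → C v ≡ false →
                  ∃ (λ e → (C (src e) xor C (dst e)) ≡ true)
  crossing-edge C here Cu Cv with ≡.trans (≡.sym Cu) Cv
  ... | ()
  crossing-edge C (fwd e path ≡.refl) Cu Cv with C (src e) in Cs
  ... | true  = e , ≡.cong₂ _xor_ Cs Cv
  ... | false = crossing-edge C path Cu Cs
  crossing-edge C (bwd e path ≡.refl) Cu Cv with C (dst e) in Cd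
  ... | true  = e , ≡.cong₂ _xor_ Cv Cd
  ... | false = crossing-edge C path Cu Cd

  cutConductance≉0 : (∀ e → 0# < r e) → Connected G →
                     ∀ (C : Fin n → Bool) {u v} → C u ≡ true → C v ≡ false → ¬ cutConductance C ≈ 0#
  cutConductance≉0 r>0 connected C {u} {v} Cu Cv K≈0 =
    pos⇒≉0 (∑-selected-⁻¹*∏-pos m (λ e → C (src e) xor C (dst e)) r r>0 (crossing-edge C (connected u v) Cu Cv))
           (trans (*-congʳ K≈0) (zeroˡ (∏ m r)))

lemma1 : ∀ {c ℓ₁ ℓ₂ : Level} (F : OrderedField c ℓ₁ ℓ₂) {n : ℕ} (G : Graph n)
           → Connected G
           → (r : Fin (Graph.m G) → OrderedField.Carrier F)
           → (∀ e → OrderedField._<_ F (OrderedField.0# F) (r e))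
           → (b : Fin n → OrderedField.Carrier F)
           → OrderedField._≈_ F (∑ F n b) (OrderedField.0# F)
           → (p : Fin n → OrderedField.Carrier F)
           → (C : Fin n → Bool)
           → ∃ (λ v → C v ≡ true)
           → ∃ (λ v → C v ≡ false)
           → let open OrderedField F
                 Δ = (S F G r b C - flow F G r p C) * R F G r C
                 p′ = λ v → p v + Δ * indicator F G r C v
             in bound F G r b p′ - bound F G r b p ≈ (Δ * Δ) * R F G r C ⁻¹
lemma1 F {n} G connected r r>0 b _ p C (u , Cu) (v , Cv) = begin
  bound F G r b p′ - bound F G r b p                               ≈⟨ bound-shift b p C Δ ⟩
  ((1# + 1#) * Δ) * (S F G r b C - flow F G r p C) - (Δ * Δ) * K   ≈⟨ quadratic-gain _ K K≉0 ⟩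
  (Δ * Δ) * R F G r C ⁻¹                                           ∎
  where
  open OrderedField F
  open OrderedFieldFacts F using (quadratic-gain)
  open ResistorNetwork F G r using (bound-shift; cutConductance; cutConductance≉0)
  open import Relation.Binary.Reasoning.Setoid setoid
  K Δ : Carrier
  K = cutConductance C
  Δ = (S F G r b C - flow F G r p C) * R F G r C
  p′ : Fin n → Carrier
  p′ v = p v + Δ * indicator F G r C v
  K≉0 : ¬ K ≈ 0#
  K≉0 = cutConductance≉0 r>0 connected C Cu Cv
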